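{- Let $D_1,\dots,D_k$ be tree degree sequences on a common set of $n$ vertices without common leaves. Then their (vertexwise) sum $\sum_{i=1}^k D_i$ is graphical, i.e. there is a simple graph on these $n$ vertices in which each vertex $v$ has degree $\sum_{i=1}^k d_v^{(i)}$.
   Context: A tree degree sequence on $n$ vertices is a list of positive integers $d_1,\dots,d_n$ with $\sum_i d_i=2n-2$. For sequences $D_1,\dots,D_k$ indexed by the same vertex set, $d_v^{(i)}$ denotes the entry of vertex $v$ in $D_i$. They have no common leaves if for every vertex $v$ and index $i$, $d_v^{(i)}=1$ implies $d_v^{(j)}>1$ for all $j\ne i$. A degree sequence is graphical if it is the degree sequence of some simple graph. -}

module Defs where

open import Data.Nat using (ℕ; zero; suc; _+_; _*_; _≤_)
open import Data.Fin using (Fin) renaming (zero to fzero; suc to fsuc)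
open import Data.Bool using (Bool; true; false)
open import Data.Product using (Σ; _×_)
open import Relation.Binary.PropositionalEquality using (_≡_; _≢_)

∑ : ∀ {m} → (Fin m → ℕ) → ℕ
∑ {zero}  f = 0
∑ {suc m} f = f fzero + ∑ (λ i → f (fsuc i))

DegSeq : ℕ → Set
DegSeq n = Fin n → ℕ

-- Tree degree sequence: positive entries summing to 2n - 2
-- (written as sum + 2 ≡ 2n to avoid truncated subtraction).
IsTreeDegSeq : ∀ {n} → DegSeq n → Set
IsTreeDegSeq {n} d = (∀ v → 1 ≤ d v) × (∑ d + 2 ≡ 2 * n)

NoCommonLeaves : ∀ {k n} → (Fin k → DegSeq n) → Set
NoCommonLeaves {k} {n} D =
  ∀ (v : Fin n) (i j : Fin k) → D i v ≡ 1 → i ≢ j → 2 ≤ D j v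

record SimpleGraph (n : ℕ) : Set where
  field
    adj   : Fin n → Fin n → Bool
    sym   : ∀ u v → adj u v ≡ adj v u
    irrefl : ∀ v → adj v v ≡ false

open SimpleGraph public

toℕ𝔹 : Bool → ℕ
toℕ𝔹 true  = 1
toℕ𝔹 false = 0

degree : ∀ {n} → SimpleGraph n → Fin n → ℕ
degree G v = ∑ (λ u → toℕ𝔹 (adj G v u))

Graphical : ∀ {n} → DegSeq n → Set
Graphical {n} d = Σ (SimpleGraph n) (λ G → ∀ v → degree G v ≡ d v)

sumSeq : ∀ {k n} → (Fin k → DegSeq n) → DegSeq n
sumSeq D v = ∑ (λ i → D i v)

module Submission where

-- With k ≥ 1 sequences put c = 2k − 1. A vertex is a leaf in at most one Dᵢ, so every entry
-- of the sum is at least c, and the tree condition gives ∑ᵥ (dᵥ − c) = n − c − 1. For odd c,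
-- degrees c + yᵥ on a vertex set P with ∑ y = ∣P∣ − c − 1 are realisable, by induction on ∑ y.
-- If ∑ y = 0 then ∣P∣ = c + 1 and the complete graph works. Otherwise take u with yᵤ = 0 and w
-- with y_w > 0, realise the instance on P ∖ u with y_w lowered by one, and hang u on w. Now u
-- has degree 1 and is raised to c two at a time: while u's closed neighbourhood has fewer than
-- c vertices there is some x outside it, x has at least c neighbours so one of them, z, lies
-- outside it too, and trading the edge xz for ux and uz changes no other degree.

open import Defs
open import Data.Nat
  using (ℕ; zero; suc; _+_; _*_; _∸_; _≤_; _<_; z≤n; s≤s; z<s; pred; _<?_; _≟_; >-nonZero)
open import Data.Nat.Properties
open import Data.Nat.Tactic.RingSolver using (solve-∀)
import Data.Fin.Properties as FP
open import Data.Fin using (Fin) renaming (zero to fzero; suc to fsuc; _≟_ to _≟ᶠ_)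
open import Data.Vec.Functional using (updateAt)
open import Data.Vec.Functional.Properties using (updateAt-updates; updateAt-minimal)
open import Data.Bool using (Bool; true; false; _∧_; _∨_; not; _xor_; if_then_else_)
open import Data.Bool.Properties
  using (∨-comm; ∧-comm; ∨-zeroʳ; ∧-zeroʳ; ∧-identityʳ; ∨-conicalˡ; ∨-conicalʳ; ∧-conicalˡ; ∧-conicalʳ)
open import Data.Product using (_×_; _,_; proj₁; proj₂; ∃-syntax; Σ-syntax)
open import Function using (_∘_)
open import Data.Empty using (⊥-elim)
open import Relation.Nullary using (Dec; does; yes; no)
open import Relation.Nullary.Decidable using (dec-true; dec-false)
open import Relation.Binary.PropositionalEquality
  using (_≡_; _≢_; refl; trans; cong; cong₂; subst; module ≡-Reasoning)
  renaming (sym to ≡-sym)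
open import Algebra.Properties.CommutativeMonoid.Sum +-0-commutativeMonoid
  as Sum using (sum)

private
  variable
    m n : ℕ

-- Finite sums

∑≡sum : (f : Fin m → ℕ) → ∑ f ≡ sum f
∑≡sum {zero}  f = refl
∑≡sum {suc m} f = cong (f fzero +_) (∑≡sum (f ∘ fsuc))

∑-cong : {f g : Fin m → ℕ} → (∀ i → f i ≡ g i) → ∑ f ≡ ∑ g
∑-cong {zero}  f≗g = refl
∑-cong {suc m} f≗g = cong₂ _+_ (f≗g fzero) (∑-cong (f≗g ∘ fsuc))

∑-const : ∀ m a → ∑ {m} (λ _ → a) ≡ m * a
∑-const zero    a = refl
∑-const (suc m) a = cong (a +_) (∑-const m a)

∑-distrib-+ : (f g : Fin m → ℕ) → ∑ (λ i → f i + g i) ≡ ∑ f + ∑ g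
∑-distrib-+ f g
  rewrite ∑≡sum (λ i → f i + g i) | ∑≡sum f | ∑≡sum g = Sum.∑-distrib-+ f g

∑-comm : (F : Fin m → Fin n → ℕ) → ∑ (λ i → ∑ (F i)) ≡ ∑ (λ j → ∑ (λ i → F i j))
∑-comm F = begin
  ∑ (λ i → ∑ (F i))             ≡⟨ ∑-cong (λ i → ∑≡sum (F i)) ⟩
  ∑ (λ i → sum (F i))           ≡⟨ ∑≡sum (λ i → sum (F i)) ⟩
  sum (λ i → sum (F i))         ≡⟨ Sum.∑-comm F ⟩
  sum (λ j → sum (λ i → F i j)) ≡⟨ ∑≡sum (λ j → sum (λ i → F i j)) ⟨
  ∑ (λ j → sum (λ i → F i j))   ≡⟨ ∑-cong (λ j → ∑≡sum (λ i → F i j)) ⟨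
  ∑ (λ j → ∑ (λ i → F i j))     ∎
  where open ≡-Reasoning

∑≡0⇒≡0 : (f : Fin m → ℕ) → ∑ f ≡ 0 → ∀ i → f i ≡ 0
∑≡0⇒≡0 f ∑f≡0 fzero    = m+n≡0⇒m≡0 (f fzero) ∑f≡0
∑≡0⇒≡0 f ∑f≡0 (fsuc i) = ∑≡0⇒≡0 (f ∘ fsuc) (m+n≡0⇒n≡0 (f fzero) ∑f≡0) i

∑-<⇒∃< : (f g : Fin m → ℕ) → ∑ f < ∑ g → ∃[ i ] f i < g i
∑-<⇒∃< {zero}  f g ()
∑-<⇒∃< {suc m} f g ∑f<∑g with f fzero <? g fzero | ∑ (f ∘ fsuc) <? ∑ (g ∘ fsuc)
... | yes f₀<g₀ | _ = fzero , f₀<g₀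
... | no _ | yes tail< = let i , fi<gi = ∑-<⇒∃< (f ∘ fsuc) (g ∘ fsuc) tail< in fsuc i , fi<gi
... | no f₀≮g₀ | no tail≮ = ⊥-elim (<⇒≱ ∑f<∑g (+-mono-≤ (≮⇒≥ f₀≮g₀) (≮⇒≥ tail≮)))

∑-suc-at : {f g : Fin m → ℕ} (i : Fin m) → g i ≡ suc (f i) →
           (∀ j → j ≢ i → g j ≡ f j) → ∑ g ≡ suc (∑ f)
∑-suc-at fzero gi≡1+fi g≗f = cong₂ _+_ gi≡1+fi (∑-cong (λ j → g≗f (fsuc j) λ ()))
∑-suc-at {f = f} (fsuc i) gi≡1+fi g≗f =
  trans (cong₂ _+_ (g≗f fzero λ ()) (∑-suc-at i gi≡1+fi λ j j≢i → g≗f (fsuc j) (j≢i ∘ FP.suc-injective)))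
        (+-suc (f fzero) _)

∣_∣ : (Fin n → Bool) → ℕ
∣ A ∣ = ∑ (λ q → toℕ𝔹 (A q))

sumOver : (Fin n → Bool) → (Fin n → ℕ) → ℕ
sumOver P y = ∑ (λ q → if P q then y q else 0)

_∖_ : (Fin n → Bool) → Fin n → Fin n → Bool
P ∖ u = updateAt P u (λ _ → false)

toℕ𝔹-< : ∀ {a b} → toℕ𝔹 a < toℕ𝔹 b → a ≡ false × b ≡ true
toℕ𝔹-< {false} {true}  _         = refl , refl
toℕ𝔹-< {true}  {true}  (s≤s ())

∣∣-<⇒∃ : (A B : Fin n → Bool) → ∣ A ∣ < ∣ B ∣ → ∃[ q ] A q ≡ false × B q ≡ true
∣∣-<⇒∃ A B ∣A∣<∣B∣ = let q , Aq<Bq = ∑-<⇒∃< _ _ ∣A∣<∣B∣ in q , toℕ𝔹-< Aq<Bq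

∣∖∣ : (P : Fin n → Bool) {u : Fin n} → P u ≡ true → ∣ P ∣ ≡ suc ∣ P ∖ u ∣
∣∖∣ P {u} Pu = ∑-suc-at u
  (trans (cong toℕ𝔹 Pu) (cong (suc ∘ toℕ𝔹) (≡-sym (updateAt-updates u P))))
  (λ q q≢u → cong toℕ𝔹 (≡-sym (updateAt-minimal q u P q≢u)))

sumOver-∖ : (P : Fin n → Bool) (y : Fin n → ℕ) {u : Fin n} → y u ≡ 0 →
            sumOver (P ∖ u) y ≡ sumOver P y
sumOver-∖ P y {u} yu≡0 = ∑-cong term
  where
  term : ∀ q → (if (P ∖ u) q then y q else 0) ≡ (if P q then y q else 0)
  term q with q ≟ᶠ u
  ... | no q≢u = cong (if_then y q else 0) (updateAt-minimal q u P q≢u)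
  ... | yes refl rewrite updateAt-updates q {λ _ → false} P | yu≡0 with P q
  ...   | true  = refl
  ...   | false = refl

sumOver-pred : (P : Fin n → Bool) (y : Fin n → ℕ) {w : Fin n} → P w ≡ true → 0 < y w →
               sumOver P y ≡ suc (sumOver P (updateAt y w pred))
sumOver-pred P y {w} Pw 0<yw = ∑-suc-at w at-w
  (λ q q≢w → cong (if P q then_else 0) (≡-sym (updateAt-minimal q w y q≢w)))
  where
  at-w : (if P w then y w else 0) ≡ suc (if P w then updateAt y w pred w else 0)
  at-w rewrite Pw | updateAt-updates w {pred} y = ≡-sym (suc-pred (y w) ⦃ >-nonZero 0<yw ⦄)

degIn : (Fin n → Bool) → SimpleGraph n → Fin n → ℕ
degIn P G v = ∣ (λ q → P q ∧ adj G v q) ∣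

GraphicalOn : (Fin n → Bool) → DegSeq n → Set
GraphicalOn {n} P d = Σ[ G ∈ SimpleGraph n ] (∀ v → P v ≡ true → degIn P G v ≡ d v)

degIn-cong : (P : Fin n → Bool) (G H : SimpleGraph n) {v : Fin n} →
             (∀ q → adj H v q ≡ adj G v q) → degIn P H v ≡ degIn P G v
degIn-cong P G H H≗G = ∑-cong (λ q → cong (λ b → toℕ𝔹 (P q ∧ b)) (H≗G q))

degIn-suc : (P : Fin n → Bool) (G H : SimpleGraph n) {v o : Fin n} → P o ≡ true →
            (∀ q → q ≢ o → adj H v q ≡ adj G v q) →
            adj G v o ≡ false → adj H v o ≡ true → degIn P H v ≡ suc (degIn P G v)
degIn-suc P G H {v} {o} Po H≗G Gvo Hvo =
  ∑-suc-at o at-o (λ q q≢o → cong (λ b → toℕ𝔹 (P q ∧ b)) (H≗G q q≢o))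
  where
  at-o : toℕ𝔹 (P o ∧ adj H v o) ≡ suc (toℕ𝔹 (P o ∧ adj G v o))
  at-o rewrite Po | Gvo | Hvo = refl

-- Graph constructions

infix 7 _≡ᵇ_

_≡ᵇ_ : Fin n → Fin n → Bool
p ≡ᵇ q = does (p ≟ᶠ q)

≡ᵇ-refl : (p : Fin n) → (p ≡ᵇ p) ≡ true
≡ᵇ-refl p = dec-true (p ≟ᶠ p) refl

≢⇒≡ᵇ-false : {p q : Fin n} → p ≢ q → (p ≡ᵇ q) ≡ false
≢⇒≡ᵇ-false {p = p} {q} = dec-false (p ≟ᶠ q)

≡ᵇ-false⇒≢ : {p q : Fin n} → (p ≡ᵇ q) ≡ false → p ≢ q
≡ᵇ-false⇒≢ {p = p} p≢ᵇp refl with trans (≡-sym (≡ᵇ-refl p)) p≢ᵇp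
... | ()

≡ᵇ-sym : (p q : Fin n) → (p ≡ᵇ q) ≡ (q ≡ᵇ p)
≡ᵇ-sym p q with p ≟ᶠ q
... | yes refl = ≡-sym (≡ᵇ-refl p)
... | no p≢q   = ≡-sym (≢⇒≡ᵇ-false (p≢q ∘ ≡-sym))

empty : SimpleGraph n
empty = record { adj = λ _ _ → false ; sym = λ _ _ → refl ; irrefl = λ _ → refl }

complete : SimpleGraph n
complete = record
  { adj    = λ p q → not (p ≡ᵇ q)
  ; sym    = λ p q → cong not (≡ᵇ-sym p q)
  ; irrefl = λ p → cong not (≡ᵇ-refl p)
  }

degIn-complete : (P : Fin n → Bool) {v : Fin n} → P v ≡ true → ∣ P ∣ ≡ suc (degIn P complete v)
degIn-complete P {v} Pv = ∑-suc-at v at-v off-v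
  where
  at-v : toℕ𝔹 (P v) ≡ suc (toℕ𝔹 (P v ∧ not (v ≡ᵇ v)))
  at-v rewrite Pv | ≡ᵇ-refl v = refl
  off-v : ∀ q → q ≢ v → toℕ𝔹 (P q) ≡ toℕ𝔹 (P q ∧ not (v ≡ᵇ q))
  off-v q q≢v rewrite ≢⇒≡ᵇ-false (q≢v ∘ ≡-sym) | ∧-identityʳ (P q) = refl

isolate : SimpleGraph n → Fin n → SimpleGraph n
isolate G u = record
  { adj    = λ p q → not (p ≡ᵇ u ∨ q ≡ᵇ u) ∧ adj G p q
  ; sym    = λ p q → cong₂ (λ b c → not b ∧ c) (∨-comm (p ≡ᵇ u) (q ≡ᵇ u)) (sym G p q)
  ; irrefl = λ p → trans (cong (not (p ≡ᵇ u ∨ p ≡ᵇ u) ∧_) (irrefl G p)) (∧-zeroʳ _)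
  }

isolate-row : (G : SimpleGraph n) (u q : Fin n) → adj (isolate G u) u q ≡ false
isolate-row G u q rewrite ≡ᵇ-refl u = refl

degIn-isolate : (P : Fin n → Bool) (G : SimpleGraph n) {u v : Fin n} → v ≢ u →
                degIn P (isolate G u) v ≡ degIn (P ∖ u) G v
degIn-isolate P G {u} {v} v≢u = ∑-cong term
  where
  term : ∀ q → toℕ𝔹 (P q ∧ adj (isolate G u) v q) ≡ toℕ𝔹 ((P ∖ u) q ∧ adj G v q)
  term q with q ≟ᶠ u
  ... | yes refl rewrite ∨-zeroʳ (v ≡ᵇ q) | ∧-zeroʳ (P q)
                       | updateAt-updates q {λ _ → false} P = refl
  ... | no q≢u rewrite ≢⇒≡ᵇ-false v≢u =
    cong (λ b → toℕ𝔹 (b ∧ adj G v q)) (≡-sym (updateAt-minimal q u P q≢u))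

degIn-isolated : (P : Fin n → Bool) (G : SimpleGraph n) (u : Fin n) → degIn P (isolate G u) u ≡ 0
degIn-isolated {n} P G u = trans (∑-cong term) (trans (∑-const n 0) (*-zeroʳ n))
  where
  term : ∀ q → toℕ𝔹 (P q ∧ adj (isolate G u) u q) ≡ 0
  term q rewrite isolate-row G u q | ∧-zeroʳ (P q) = refl

isPair : Fin n → Fin n → Fin n → Fin n → Bool
isPair a b p q = p ≡ᵇ a ∧ q ≡ᵇ b ∨ p ≡ᵇ b ∧ q ≡ᵇ a

isPair-sym : (a b p q : Fin n) → isPair a b p q ≡ isPair a b q p
isPair-sym a b p q = trans (∨-comm (p ≡ᵇ a ∧ q ≡ᵇ b) (p ≡ᵇ b ∧ q ≡ᵇ a))
  (cong₂ _∨_ (∧-comm (p ≡ᵇ b) (q ≡ᵇ a)) (∧-comm (p ≡ᵇ a) (q ≡ᵇ b)))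

isPair-diag : {a b : Fin n} → a ≢ b → ∀ p → isPair a b p p ≡ false
isPair-diag {a = a} {b} a≢b p with p ≟ᶠ a | p ≟ᶠ b
... | yes refl | yes refl = ⊥-elim (a≢b refl)
... | yes _    | no _     = refl
... | no _     | yes _    = refl
... | no _     | no _     = refl

toggle : (G : SimpleGraph n) (a b : Fin n) → a ≢ b → SimpleGraph n
toggle G a b a≢b = record
  { adj    = λ p q → isPair a b p q xor adj G p q
  ; sym    = λ p q → cong₂ _xor_ (isPair-sym a b p q) (sym G p q)
  ; irrefl = λ p → trans (cong (_xor adj G p p) (isPair-diag a≢b p)) (irrefl G p)
  }

module _ (G : SimpleGraph n) {a b : Fin n} (a≢b : a ≢ b) where

  private
    T = toggle G a b a≢b
    b≢a = a≢b ∘ ≡-sym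

  toggle-at : adj T a b ≡ not (adj G a b)
  toggle-at rewrite ≡ᵇ-refl a | ≡ᵇ-refl b = refl

  toggle-at′ : adj T b a ≡ not (adj G b a)
  toggle-at′ rewrite ≡ᵇ-refl a | ≡ᵇ-refl b | ≢⇒≡ᵇ-false b≢a = refl

  toggle-row : ∀ q → q ≢ b → adj T a q ≡ adj G a q
  toggle-row q q≢b rewrite ≡ᵇ-refl a | ≢⇒≡ᵇ-false q≢b | ≢⇒≡ᵇ-false a≢b = refl

  toggle-row′ : ∀ q → q ≢ a → adj T b q ≡ adj G b q
  toggle-row′ q q≢a rewrite ≡ᵇ-refl b | ≢⇒≡ᵇ-false q≢a | ≢⇒≡ᵇ-false b≢a = refl

  toggle-elsewhere : ∀ {v} → v ≢ a → v ≢ b → ∀ q → adj T v q ≡ adj G v q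
  toggle-elsewhere v≢a v≢b q rewrite ≢⇒≡ᵇ-false v≢a | ≢⇒≡ᵇ-false v≢b = refl

  module _ (P : Fin n → Bool) where

    degIn-toggle-other : ∀ {v} → v ≢ a → v ≢ b → degIn P T v ≡ degIn P G v
    degIn-toggle-other v≢a v≢b = degIn-cong P G T (toggle-elsewhere v≢a v≢b)

    degIn-toggle-add : P b ≡ true → adj G a b ≡ false → degIn P T a ≡ suc (degIn P G a)
    degIn-toggle-add Pb Gab = degIn-suc P G T Pb toggle-row Gab (trans toggle-at (cong not Gab))

    degIn-toggle-add′ : P a ≡ true → adj G a b ≡ false → degIn P T b ≡ suc (degIn P G b)
    degIn-toggle-add′ Pa Gab = degIn-suc P G T Pa toggle-row′ Gba (trans toggle-at′ (cong not Gba))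
      where Gba = trans (sym G b a) Gab

    degIn-toggle-remove : P b ≡ true → adj G a b ≡ true → degIn P G a ≡ suc (degIn P T a)
    degIn-toggle-remove Pb Gab =
      degIn-suc P T G Pb (λ q q≢b → ≡-sym (toggle-row q q≢b)) (trans toggle-at (cong not Gab)) Gab

    degIn-toggle-remove′ : P a ≡ true → adj G a b ≡ true → degIn P G b ≡ suc (degIn P T b)
    degIn-toggle-remove′ Pa Gab =
      degIn-suc P T G Pa (λ q q≢a → ≡-sym (toggle-row′ q q≢a)) (trans toggle-at′ (cong not Gba)) Gba
      where Gba = trans (sym G b a) Gab

pendant : SimpleGraph n → (u w : Fin n) → u ≢ w → SimpleGraph n
pendant G u w u≢w = toggle (isolate G u) u w u≢w

module _ (P : Fin n → Bool) (G : SimpleGraph n) {u w : Fin n} (u≢w : u ≢ w) where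

  degIn-pendant-leaf : P w ≡ true → degIn P (pendant G u w u≢w) u ≡ 1
  degIn-pendant-leaf Pw = trans (degIn-toggle-add (isolate G u) u≢w P Pw (isolate-row G u w))
                                (cong suc (degIn-isolated P G u))

  degIn-pendant-root : P u ≡ true → degIn P (pendant G u w u≢w) w ≡ suc (degIn (P ∖ u) G w)
  degIn-pendant-root Pu = trans (degIn-toggle-add′ (isolate G u) u≢w P Pu (isolate-row G u w))
                                (cong suc (degIn-isolate P G (u≢w ∘ ≡-sym)))

  degIn-pendant-other : ∀ {v} → v ≢ u → v ≢ w → degIn P (pendant G u w u≢w) v ≡ degIn (P ∖ u) G v
  degIn-pendant-other v≢u v≢w = trans (degIn-toggle-other (isolate G u) u≢w P v≢u v≢w)
                                      (degIn-isolate P G v≢u)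

closedNbhdIn : (Fin n → Bool) → SimpleGraph n → Fin n → Fin n → Bool
closedNbhdIn P G u q = P q ∧ (q ≡ᵇ u ∨ adj G u q)

∣closedNbhdIn∣ : (P : Fin n → Bool) (G : SimpleGraph n) {u : Fin n} → P u ≡ true →
                 ∣ closedNbhdIn P G u ∣ ≡ suc (degIn P G u)
∣closedNbhdIn∣ P G {u} Pu = ∑-suc-at u at-u off-u
  where
  at-u : toℕ𝔹 (closedNbhdIn P G u u) ≡ suc (toℕ𝔹 (P u ∧ adj G u u))
  at-u rewrite Pu | ≡ᵇ-refl u | irrefl G u = refl
  off-u : ∀ q → q ≢ u → toℕ𝔹 (closedNbhdIn P G u q) ≡ toℕ𝔹 (P q ∧ adj G u q)
  off-u q q≢u rewrite ≢⇒≡ᵇ-false q≢u = refl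

∉closedNbhdIn : (P : Fin n → Bool) (G : SimpleGraph n) {u q : Fin n} → P q ≡ true →
                closedNbhdIn P G u q ≡ false → q ≢ u × adj G u q ≡ false
∉closedNbhdIn P G {u} {q} Pq q∉N =
  ≡ᵇ-false⇒≢ (∨-conicalˡ _ _ q∉N′) , ∨-conicalʳ (q ≡ᵇ u) _ q∉N′
  where
  q∉N′ : (q ≡ᵇ u ∨ adj G u q) ≡ false
  q∉N′ = trans (cong (_∧ (q ≡ᵇ u ∨ adj G u q)) (≡-sym Pq)) q∉N

Raises : (Fin n → Bool) → Fin n → ℕ → SimpleGraph n → SimpleGraph n → Set
Raises P u k G H = (∀ v → v ≢ u → degIn P H v ≡ degIn P G v) × degIn P H u ≡ k + degIn P G u

Raises-trans : (P : Fin n → Bool) {u : Fin n} {k l : ℕ} {G H K : SimpleGraph n} →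
               Raises P u k G H → Raises P u l H K → Raises P u (l + k) G K
Raises-trans P {u} {k} {l} {G} (keep₁ , gain₁) (keep₂ , gain₂) =
  (λ v v≢u → trans (keep₂ v v≢u) (keep₁ v v≢u)) ,
  trans gain₂ (trans (cong (l +_) gain₁) (≡-sym (+-assoc l k (degIn P G u))))

rewire : (P : Fin n → Bool) (G : SimpleGraph n) {u x z : Fin n} →
         P u ≡ true → P x ≡ true → P z ≡ true → u ≢ x → u ≢ z →
         adj G u x ≡ false → adj G u z ≡ false → adj G x z ≡ true →
         Σ[ H ∈ SimpleGraph n ] Raises P u 2 G H
rewire {n} P G {u} {x} {z} Pu Px Pz u≢x u≢z Gux Guz Gxz = G₃ , keep , gain
  where
  x≢z : x ≢ z
  x≢z refl with trans (≡-sym Gxz) (irrefl G x)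
  ... | ()
  z≢x : z ≢ x
  z≢x = x≢z ∘ ≡-sym
  x≢u : x ≢ u
  x≢u = u≢x ∘ ≡-sym
  z≢u : z ≢ u
  z≢u = u≢z ∘ ≡-sym

  G₁ G₂ G₃ : SimpleGraph n
  G₁ = toggle G x z x≢z
  G₂ = toggle G₁ u x u≢x
  G₃ = toggle G₂ u z u≢z

  G₁ux : adj G₁ u x ≡ false
  G₁ux = trans (toggle-elsewhere G x≢z u≢x u≢z x) Gux

  G₂uz : adj G₂ u z ≡ false
  G₂uz = trans (toggle-row G₁ u≢x z z≢x) (trans (toggle-elsewhere G x≢z u≢x u≢z z) Guz)

  gain : degIn P G₃ u ≡ 2 + degIn P G u
  gain = begin
    degIn P G₃ u             ≡⟨ degIn-toggle-add G₂ u≢z P Pz G₂uz ⟩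
    suc (degIn P G₂ u)       ≡⟨ cong suc (degIn-toggle-add G₁ u≢x P Px G₁ux) ⟩
    2 + degIn P G₁ u         ≡⟨ cong (2 +_) (degIn-toggle-other G x≢z P u≢x u≢z) ⟩
    2 + degIn P G u          ∎
    where open ≡-Reasoning

  keep : ∀ v → v ≢ u → degIn P G₃ v ≡ degIn P G v
  keep v v≢u = by-cases (v ≟ᶠ x) (v ≟ᶠ z)
    where
    by-cases : Dec (v ≡ x) → Dec (v ≡ z) → degIn P G₃ v ≡ degIn P G v
    by-cases (yes refl) _ = begin
      degIn P G₃ x             ≡⟨ degIn-toggle-other G₂ u≢z P x≢u x≢z ⟩
      degIn P G₂ x             ≡⟨ degIn-toggle-add′ G₁ u≢x P Pu G₁ux ⟩
      suc (degIn P G₁ x)       ≡⟨ degIn-toggle-remove G x≢z P Pz Gxz ⟨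
      degIn P G x              ∎
      where open ≡-Reasoning
    by-cases (no _) (yes refl) = begin
      degIn P G₃ z             ≡⟨ degIn-toggle-add′ G₂ u≢z P Pu G₂uz ⟩
      suc (degIn P G₂ z)       ≡⟨ cong suc (degIn-toggle-other G₁ u≢x P z≢u z≢x) ⟩
      suc (degIn P G₁ z)       ≡⟨ degIn-toggle-remove′ G x≢z P Px Gxz ⟨
      degIn P G z              ∎
      where open ≡-Reasoning
    by-cases (no v≢x) (no v≢z) = begin
      degIn P G₃ v             ≡⟨ degIn-toggle-other G₂ u≢z P v≢u v≢z ⟩
      degIn P G₂ v             ≡⟨ degIn-toggle-other G₁ u≢x P v≢u v≢x ⟩
      degIn P G₁ v             ≡⟨ degIn-toggle-other G x≢z P v≢x v≢z ⟩
      degIn P G v              ∎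
      where open ≡-Reasoning

raise-by-2 : (P : Fin n → Bool) {u : Fin n} {c : ℕ} → P u ≡ true → c ≤ ∣ P ∣ →
             (G : SimpleGraph n) → suc (degIn P G u) < c →
             (∀ v → P v ≡ true → v ≢ u → c ≤ degIn P G v) →
             Σ[ H ∈ SimpleGraph n ] Raises P u 2 G H
raise-by-2 P {u} {c} Pu c≤∣P∣ G 1+d<c high
  with ∣N[u]∣<c ← subst (_< c) (≡-sym (∣closedNbhdIn∣ P G Pu)) 1+d<c
  with x , x∉N , Px ← ∣∣-<⇒∃ (closedNbhdIn P G u) P (<-≤-trans ∣N[u]∣<c c≤∣P∣)
  with x≢u , Gux ← ∉closedNbhdIn P G Px x∉N
  with z , z∉N , Pz∧Gxz ← ∣∣-<⇒∃ (closedNbhdIn P G u) (λ q → P q ∧ adj G x q)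
                                  (<-≤-trans ∣N[u]∣<c (high x Px x≢u))
  with Pz ← ∧-conicalˡ (P z) _ Pz∧Gxz
  with z≢u , Guz ← ∉closedNbhdIn P G Pz z∉N
  = rewire P G Pu Px Pz (x≢u ∘ ≡-sym) (z≢u ∘ ≡-sym) Gux Guz (∧-conicalʳ (P z) _ Pz∧Gxz)

raise : (P : Fin n → Bool) {u : Fin n} {c : ℕ} → P u ≡ true → c ≤ ∣ P ∣ →
        ∀ r (G : SimpleGraph n) → r + r + degIn P G u ≤ c →
        (∀ v → P v ≡ true → v ≢ u → c ≤ degIn P G v) →
        Σ[ H ∈ SimpleGraph n ] Raises P u (r + r) G H
raise P Pu c≤∣P∣ zero G _ _ = G , (λ _ _ → refl) , refl
raise {n} P {u} {c} Pu c≤∣P∣ (suc r) G room high =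
  K , subst (λ k → Raises P u k G K) 2r+2≡2[r+1] (Raises-trans P {G = G} {H} {K} (proj₂ step) (proj₂ rest))
  where
  2r+2≡2[r+1] : r + r + 2 ≡ suc r + suc r
  2r+2≡2[r+1] = trans (+-comm (r + r) 2) (cong suc (≡-sym (+-suc r r)))

  room′ : r + r + (2 + degIn P G u) ≤ c
  room′ = subst (_≤ c) (trans (cong (_+ degIn P G u) (≡-sym 2r+2≡2[r+1])) (+-assoc (r + r) 2 _)) room

  step : Σ[ H ∈ SimpleGraph n ] Raises P u 2 G H
  step = raise-by-2 P Pu c≤∣P∣ G (≤-trans (m≤n+m (2 + degIn P G u) (r + r)) room′) high
  H : SimpleGraph n
  H = proj₁ step

  rest : Σ[ K ∈ SimpleGraph n ] Raises P u (r + r) H K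
  rest = raise P Pu c≤∣P∣ r H (subst (λ e → r + r + e ≤ c) (≡-sym (proj₂ (proj₂ step))) room′)
           (λ v Pv v≢u → subst (c ≤_) (≡-sym (proj₁ (proj₂ step) v v≢u)) (high v Pv v≢u))
  K : SimpleGraph n
  K = proj₁ rest

-- Realising the degrees c + y for odd c

if-positive : ∀ b {a} → 0 < (if b then a else 0) → b ≡ true × 0 < a
if-positive true 0<a = refl , 0<a

if-below : ∀ b {a} → (if b then a else 0) < toℕ𝔹 b → b ≡ true × a ≡ 0
if-below true a<1 = refl , n<1⇒n≡0 a<1

pendant-realises : (c : ℕ) (P : Fin n → Bool) (y : Fin n → ℕ) (G : SimpleGraph n) {u w : Fin n} →
                   (u≢w : u ≢ w) → P u ≡ true → 0 < y w →
                   (∀ v → (P ∖ u) v ≡ true → degIn (P ∖ u) G v ≡ c + updateAt y w pred v) →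
                   ∀ v → P v ≡ true → v ≢ u → degIn P (pendant G u w u≢w) v ≡ c + y v
pendant-realises c P y G {u} {w} u≢w Pu 0<yw G-realises v Pv v≢u = by-cases (v ≟ᶠ w)
  where
  P∖u-v : (P ∖ u) v ≡ true
  P∖u-v = trans (updateAt-minimal v u P v≢u) Pv
  by-cases : Dec (v ≡ w) → degIn P (pendant G u w u≢w) v ≡ c + y v
  by-cases (yes refl) = begin
    degIn P (pendant G u v u≢w) v   ≡⟨ degIn-pendant-root P G u≢w Pu ⟩
    suc (degIn (P ∖ u) G v)         ≡⟨ cong suc (G-realises v P∖u-v) ⟩
    suc (c + updateAt y v pred v)   ≡⟨ cong (suc ∘ (c +_)) (updateAt-updates v y) ⟩
    suc (c + pred (y v))            ≡⟨ +-suc c (pred (y v)) ⟨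
    c + suc (pred (y v))            ≡⟨ cong (c +_) (suc-pred (y v) ⦃ >-nonZero 0<yw ⦄) ⟩
    c + y v                         ∎
    where open ≡-Reasoning
  by-cases (no v≢w) = begin
    degIn P (pendant G u w u≢w) v   ≡⟨ degIn-pendant-other P G u≢w v≢u v≢w ⟩
    degIn (P ∖ u) G v               ≡⟨ G-realises v P∖u-v ⟩
    c + updateAt y w pred v         ≡⟨ cong (c +_) (updateAt-minimal v w y v≢w) ⟩
    c + y v                         ∎
    where open ≡-Reasoning

graphicalOn-extend : (m : ℕ) (P : Fin n → Bool) (y : Fin n → ℕ) {u w : Fin n} → u ≢ w →
                     P u ≡ true → P w ≡ true → y u ≡ 0 → 0 < y w → suc (m + m) ≤ ∣ P ∣ →
                     GraphicalOn (P ∖ u) (λ v → suc (m + m) + updateAt y w pred v) →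
                     GraphicalOn P (λ v → suc (m + m) + y v)
graphicalOn-extend {n} m P y {u} {w} u≢w Pu Pw yu≡0 0<yw c≤∣P∣ (G , G-realises) = H , H-realises
  where
  c : ℕ
  c = suc (m + m)
  G₁ : SimpleGraph n
  G₁ = pendant G u w u≢w
  G₁-realises : ∀ v → P v ≡ true → v ≢ u → degIn P G₁ v ≡ c + y v
  G₁-realises = pendant-realises c P y G u≢w Pu 0<yw G-realises
  2m+deg≡c : m + m + degIn P G₁ u ≡ c
  2m+deg≡c = trans (cong (m + m +_) (degIn-pendant-leaf P G u≢w Pw)) (+-comm (m + m) 1)

  raised : Σ[ H ∈ SimpleGraph n ] Raises P u (m + m) G₁ H
  raised = raise P Pu c≤∣P∣ m G₁ (≤-reflexive 2m+deg≡c)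
    (λ v Pv v≢u → subst (c ≤_) (≡-sym (G₁-realises v Pv v≢u)) (m≤m+n c (y v)))
  H : SimpleGraph n
  H = proj₁ raised

  H-realises : ∀ v → P v ≡ true → degIn P H v ≡ c + y v
  H-realises v Pv = by-cases (v ≟ᶠ u)
    where
    by-cases : Dec (v ≡ u) → degIn P H v ≡ c + y v
    by-cases (yes refl) = begin
      degIn P H v                     ≡⟨ proj₂ (proj₂ raised) ⟩
      m + m + degIn P G₁ v            ≡⟨ 2m+deg≡c ⟩
      c                               ≡⟨ +-identityʳ c ⟨
      c + 0                           ≡⟨ cong (c +_) yu≡0 ⟨
      c + y v                         ∎
      where open ≡-Reasoning
    by-cases (no v≢u) = trans (proj₁ (proj₂ raised) v v≢u) (G₁-realises v Pv v≢u)

-- Oddness of c = 2m + 1 is what lets raise lift the pendant vertex from degree 1 to c.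
graphicalOn-excess : (m s : ℕ) (P : Fin n → Bool) (y : Fin n → ℕ) → sumOver P y ≡ s →
                     s + suc (suc (m + m)) ≡ ∣ P ∣ → GraphicalOn P (λ v → suc (m + m) + y v)
graphicalOn-excess m zero P y ∑y≡0 c+1≡∣P∣ = complete , realises
  where
  c : ℕ
  c = suc (m + m)
  realises : ∀ v → P v ≡ true → degIn P complete v ≡ c + y v
  realises v Pv = begin
    degIn P complete v     ≡⟨ suc-injective (trans c+1≡∣P∣ (degIn-complete P Pv)) ⟨
    c                      ≡⟨ +-identityʳ c ⟨
    c + 0                  ≡⟨ cong (c +_) yv≡0 ⟨
    c + y v                ∎
    where
    open ≡-Reasoning
    yv≡0 : y v ≡ 0
    yv≡0 = trans (cong (if_then y v else 0) (≡-sym Pv)) (∑≡0⇒≡0 _ ∑y≡0 v)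
graphicalOn-excess {n} m (suc s) P y ∑y≡1+s s+c+1≡∣P∣ =
  graphicalOn-extend m P y u≢w Pu Pw yu≡0 0<yw c≤∣P∣
    (graphicalOn-excess m s (P ∖ u) (updateAt y w pred) ∑y′≡s (suc-injective (trans s+c+1≡∣P∣ (∣∖∣ P Pu))))
  where
  c : ℕ
  c = suc (m + m)

  0<∑y : ∑ {n} (λ _ → 0) < sumOver P y
  0<∑y rewrite ∑-const n 0 | *-zeroʳ n | ∑y≡1+s = s≤s z≤n
  w-found : ∃[ w ] 0 < (if P w then y w else 0)
  w-found = ∑-<⇒∃< _ _ 0<∑y
  w : Fin n
  w = proj₁ w-found
  Pw : P w ≡ true
  Pw = proj₁ (if-positive (P w) (proj₂ w-found))
  0<yw : 0 < y w
  0<yw = proj₂ (if-positive (P w) (proj₂ w-found))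

  ∑y<∣P∣ : sumOver P y < ∣ P ∣
  ∑y<∣P∣ rewrite ∑y≡1+s | ≡-sym s+c+1≡∣P∣ = m<m+n (suc s) z<s
  u-found : ∃[ u ] (if P u then y u else 0) < toℕ𝔹 (P u)
  u-found = ∑-<⇒∃< _ _ ∑y<∣P∣
  u : Fin n
  u = proj₁ u-found
  Pu : P u ≡ true
  Pu = proj₁ (if-below (P u) (proj₂ u-found))
  yu≡0 : y u ≡ 0
  yu≡0 = proj₂ (if-below (P u) (proj₂ u-found))

  u≢w : u ≢ w
  u≢w u≡w = <⇒≢ 0<yw (≡-sym (trans (cong y (≡-sym u≡w)) yu≡0))

  c≤∣P∣ : c ≤ ∣ P ∣
  c≤∣P∣ = ≤-trans (n≤1+n c) (≤-trans (m≤n+m (suc c) (suc s)) (≤-reflexive s+c+1≡∣P∣))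

  ∑y′≡s : sumOver (P ∖ u) (updateAt y w pred) ≡ s
  ∑y′≡s = suc-injective (begin
    suc (sumOver (P ∖ u) (updateAt y w pred))   ≡⟨ sumOver-pred (P ∖ u) y P∖u-w 0<yw ⟨
    sumOver (P ∖ u) y                           ≡⟨ sumOver-∖ P y yu≡0 ⟩
    sumOver P y                                 ≡⟨ ∑y≡1+s ⟩
    suc s                                       ∎)
    where
    open ≡-Reasoning
    P∖u-w : (P ∖ u) w ≡ true
    P∖u-w = trans (updateAt-minimal w u P (u≢w ∘ ≡-sym)) Pw

-- Sums of tree degree sequences

k+k≤∑ : ∀ {k} (f : Fin k → ℕ) → (∀ i → 2 ≤ f i) → k + k ≤ ∑ f
k+k≤∑ {zero}  f 2≤f = z≤n
k+k≤∑ {suc k} f 2≤f = subst (_≤ ∑ f) (cong suc (≡-sym (+-suc k k)))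
  (+-mono-≤ (2≤f fzero) (k+k≤∑ (f ∘ fsuc) (2≤f ∘ fsuc)))

k+k≤1+∑ : ∀ {k} (f : Fin k → ℕ) → (∀ i → 1 ≤ f i) →
          (∀ i j → f i ≡ 1 → i ≢ j → 2 ≤ f j) → k + k ≤ suc (∑ f)
k+k≤1+∑ {zero}  f _ _ = z≤n
k+k≤1+∑ {suc k} f 1≤f single with f fzero ≟ 1
... | yes f₀≡1 rewrite f₀≡1 | +-suc k k =
  s≤s (s≤s (k+k≤∑ (f ∘ fsuc) (λ j → single fzero (fsuc j) f₀≡1 λ ())))
... | no f₀≢1 rewrite +-suc k k | ≡-sym (+-suc (f fzero) (∑ (f ∘ fsuc))) =
  +-mono-≤ (≤∧≢⇒< (1≤f fzero) (f₀≢1 ∘ ≡-sym))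
           (k+k≤1+∑ (f ∘ fsuc) (1≤f ∘ fsuc)
              λ i j fi≡1 i≢j → single (fsuc i) (fsuc j) fi≡1 (i≢j ∘ FP.suc-injective))

∑-sumSeq : ∀ {k n} (D : Fin k → DegSeq n) → (∀ i → IsTreeDegSeq (D i)) →
           ∑ (sumSeq D) + k * 2 ≡ k * (2 * n)
∑-sumSeq {k} {n} D trees = begin
  ∑ (sumSeq D) + k * 2                   ≡⟨ cong₂ _+_ (∑-comm (λ v i → D i v)) (≡-sym (∑-const k 2)) ⟩
  ∑ (λ i → ∑ (D i)) + ∑ {k} (λ _ → 2)    ≡⟨ ∑-distrib-+ (λ i → ∑ (D i)) (λ _ → 2) ⟨
  ∑ (λ i → ∑ (D i) + 2)                  ≡⟨ ∑-cong (λ i → proj₂ (trees i)) ⟩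
  ∑ {k} (λ _ → 2 * n)                    ≡⟨ ∑-const k (2 * n) ⟩
  k * (2 * n)                            ∎
  where open ≡-Reasoning

sumSeq-lower-bound : ∀ {k n} (D : Fin (suc k) → DegSeq n) → (∀ i → IsTreeDegSeq (D i)) →
                     NoCommonLeaves D → ∀ v → suc (k + k) ≤ sumSeq D v
sumSeq-lower-bound {k} D trees no-common v = subst (_≤ sumSeq D v) (+-suc k k)
  (≤-pred (k+k≤1+∑ (λ i → D i v) (λ i → proj₁ (trees i) v) (no-common v)))

∑-excess : ∀ {k n} (D : Fin (suc k) → DegSeq n) → (∀ i → IsTreeDegSeq (D i)) →
           (∀ v → suc (k + k) ≤ sumSeq D v) →
           ∑ (λ v → sumSeq D v ∸ suc (k + k)) + suc (suc (k + k)) ≡ n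
∑-excess {k} {n} D trees c≤s = +-cancelʳ-≡ (n * c) _ _ (begin
  ∑ y + suc c + n * c        ≡⟨ swap (∑ y) (suc c) (n * c) ⟩
  ∑ y + n * c + suc c        ≡⟨ cong₂ _+_ ∑y+nc≡∑s (double k) ⟩
  ∑ (sumSeq D) + suc k * 2   ≡⟨ ∑-sumSeq D trees ⟩
  suc k * (2 * n)            ≡⟨ expand n k ⟩
  n + n * c                  ∎)
  where
  open ≡-Reasoning
  c : ℕ
  c = suc (k + k)

  y : Fin n → ℕ
  y v = sumSeq D v ∸ c

  ∑y+nc≡∑s : ∑ y + n * c ≡ ∑ (sumSeq D)
  ∑y+nc≡∑s = begin
    ∑ y + n * c                ≡⟨ cong (∑ y +_) (∑-const n c) ⟨
    ∑ y + ∑ {n} (λ _ → c)      ≡⟨ ∑-distrib-+ y (λ _ → c) ⟨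
    ∑ (λ v → y v + c)          ≡⟨ ∑-cong (λ v → m∸n+n≡m (c≤s v)) ⟩
    ∑ (sumSeq D)               ∎

  swap : ∀ a b d → a + b + d ≡ a + d + b
  swap = solve-∀
  double : ∀ k → suc (suc (k + k)) ≡ suc k * 2
  double = solve-∀
  expand : ∀ n k → suc k * (2 * n) ≡ n + n * suc (k + k)
  expand = solve-∀

theorem1 : (k n : ℕ) (D : Fin k → DegSeq n) →
    (∀ i → IsTreeDegSeq (D i)) →
    NoCommonLeaves D →
    Graphical (sumSeq D)
theorem1 zero n D _ _ = empty , λ _ → trans (∑-const n 0) (*-zeroʳ n)
theorem1 (suc k) n D trees no-common
  with c≤s ← sumSeq-lower-bound D trees no-common
  with G , G-realises ← graphicalOn-excess k _ (λ _ → true) (λ v → sumSeq D v ∸ suc (k + k)) refl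
                          (trans (∑-excess D trees c≤s) (≡-sym (trans (∑-const n 1) (*-identityʳ n))))
  = G , λ v → trans (G-realises v refl) (m+[n∸m]≡n (c≤s v))
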